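{- For all positive integers $k,\ell,m$, $$\begin{aligned}\mathrm{S}_\ominus(k,\ell\mid k,m)={}&\mathrm{S}_\ominus(k,\ell-1\mid k,m)+\mathrm{S}_\ominus(k,\ell\mid k,m-1)-\mathrm{S}_\ominus(k,\ell-1\mid k,m-1)\\&+\mathrm{S}_\ominus(k-1,\ell\mid k-1,m)+|\ell-m|\cdot|\mathrm{Par}((k-1)\times\ell)|\cdot|\mathrm{Par}((k-1)\times m)|.\end{aligned}$$
   Context: A partition is identified with its Young diagram (a left-justified array of boxes whose row lengths, from top to bottom, are the parts), viewed as a finite set of boxes. For nonnegative integers $a,b$, let $\mathrm{Par}(a\times b)$ denote the set of partitions with at most $a$ parts, each part at most $b$ (i.e. Young diagrams fitting inside a rectangle with $a$ rows and $b$ columns); $\mathrm{Par}(0\times b)=\mathrm{Par}(a\times 0)=\{\varnothing\}$. For Young diagrams $\lambda,\mu$, the symmetric difference $\lambda\ominus\mu=(\lambda\cup\mu)\setminus(\lambda\cap\mu)$ is the set of boxes lying in exactly one of the two diagrams. Define $$\mathrm{S}_\ominus(a,b\mid c,d)=\sum_{\lambda\in\mathrm{Par}(a\times b),\ \mu\in\mathrm{Par}(c\times d)}|\lambda\ominus\mu|.$$ -}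

module Defs where

open import Data.Nat using (ℕ; zero; suc; _+_; _*_; _∸_; _≤ᵇ_; _<ᵇ_)
open import Data.Bool using (Bool; true; false; _xor_; if_then_else_)
open import Data.List using (List; []; _∷_; length; map; concatMap; upTo)
open import Data.Nat.ListAction using (sum)
open import Data.Vec using (Vec; []; _∷_)

-- A partition with at most a parts, each at most b, is represented by its
-- row lengths padded with zeros to exactly a rows: a weakly decreasing
-- vector (λ₁ ≥ λ₂ ≥ … ≥ λₐ) of entries in {0,…,b}.  This is a bijection
-- with Par(a×b).

Par : (a b : ℕ) → List (Vec ℕ a)
Par zero    b = [] ∷ []
Par (suc a) b =
  concatMap (λ x → map (x ∷_) (Par a x)) (upTo (suc b))

row : ∀ {a} → Vec ℕ a → ℕ → ℕ
row []       i       = 0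
row (x ∷ xs) zero    = x
row (x ∷ xs) (suc i) = row xs i

inDiagram : ∀ {a} → Vec ℕ a → ℕ → ℕ → Bool
inDiagram λ' i j = j <ᵇ row λ' i

-- |λ ⊖ μ|: number of boxes lying in exactly one of the two diagrams.
-- All boxes of either diagram lie in rows < R and columns < C.
symDiffCard : ∀ {a c} → (R C : ℕ) → Vec ℕ a → Vec ℕ c → ℕ
symDiffCard R C λ' μ =
  sum (map (λ i → sum (map (λ j →
        if inDiagram λ' i j xor inDiagram μ i j then 1 else 0)
      (upTo C))) (upTo R))

S⊖ : (a b c d : ℕ) → ℕ
S⊖ a b c d =
  sum (concatMap (λ λ' → map (λ μ → symDiffCard (a + c) (b + d) λ' μ)
                              (Par c d))
                 (Par a b))

#Par : (a b : ℕ) → ℕ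
#Par a b = length (Par a b)

absDiff : ℕ → ℕ → ℕ
absDiff m n = (m ∸ n) + (n ∸ m)

-- Two diagrams with the same number of rows differ in Σᵢ |λᵢ − μᵢ| boxes, so
-- S⊖(k,ℓ | k,m) is the total ℓ¹-distance between the row vectors of the two
-- families.  Splitting both families by their first rows x ≤ ℓ and y ≤ m, the
-- pair (x,y) contributes |x − y|·|Par((k−1)×x)|·|Par((k−1)×y)| from the first
-- row plus S⊖(k−1,x | k−1,y) from the others, so S⊖(k,ℓ | k,m) is a sum of
-- these block terms over the rectangle [0,ℓ]×[0,m].  The recurrence is
-- inclusion–exclusion for such rectangle sums, the corner block (ℓ,m) being
-- the last two terms.
{-# OPTIONS --safe #-}
module Submission where

open import Defs
open import Data.Nat using (ℕ; _∸_; _*_; _≤_)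
open import Data.Integer using (ℤ; +_; _+_; _-_)
open import Relation.Binary.PropositionalEquality using (_≡_)

open import Data.Nat as ℕ using (zero; suc; z≤n; s≤s; _<ᵇ_)
open import Data.Nat.Properties using (*-zeroʳ; +-identityʳ; 0∸n≡0; ≤-trans; ≤-pred; m≤m+n; m≤n+m)
open import Data.Nat.ListAction using (sum)
open import Data.Nat.ListAction.Properties using (sum-++)
open import Data.Nat.Tactic.RingSolver using (solve-∀)
open import Data.Integer.Properties using (pos-+)
import Data.Integer.Tactic.RingSolver as ℤ-Solver
open import Data.Bool using (_xor_; if_then_else_)
open import Data.List using (List; []; _∷_; _++_; [_]; length; map; concatMap; upTo; applyUpTo)
open import Function using (_∘_)
open import Data.List.Properties using (map-++; map-∘; map-cong; map-cong-local; map-concatMap; map-applyUpTo; map-upTo; upTo-∷ʳ)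
open import Data.List.Relation.Unary.All as All using (All; []; _∷_)
open import Data.List.Relation.Unary.All.Properties using (concat⁺; map⁺; applyUpTo⁺₁)
open import Data.Vec using (Vec; []; _∷_)
open import Relation.Binary.PropositionalEquality using (refl; sym; trans; cong; cong₂; module ≡-Reasoning)

open ≡-Reasoning

∑ : {A : Set} → List A → (A → ℕ) → ℕ
∑ xs f = sum (map f xs)

syntax ∑ xs (λ x → e) = ∑[ x ∈ xs ] e

private
  variable
    A B : Set

∑-cong : ∀ (xs : List A) {f g : A → ℕ} → (∀ x → f x ≡ g x) → ∑ xs f ≡ ∑ xs g
∑-cong xs f≗g = cong sum (map-cong f≗g xs)

∑-cong-All : ∀ {P : A → Set} {xs : List A} {f g : A → ℕ} →
             All P xs → (∀ {x} → P x → f x ≡ g x) → ∑ xs f ≡ ∑ xs g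
∑-cong-All ps f≗g = cong sum (map-cong-local (All.map f≗g ps))

∑-++ : ∀ (xs ys : List A) f → ∑ (xs ++ ys) f ≡ ∑ xs f ℕ.+ ∑ ys f
∑-++ xs ys f = trans (cong sum (map-++ f xs ys)) (sum-++ (map f xs) (map f ys))

∑-+ : ∀ (xs : List A) f g → ∑[ x ∈ xs ] (f x ℕ.+ g x) ≡ ∑ xs f ℕ.+ ∑ xs g
∑-+ []       f g = refl
∑-+ (x ∷ xs) f g = trans (cong (f x ℕ.+ g x ℕ.+_) (∑-+ xs f g)) (interchange (f x) (g x) _ _)
  where
  interchange : ∀ a b c d → a ℕ.+ b ℕ.+ (c ℕ.+ d) ≡ a ℕ.+ c ℕ.+ (b ℕ.+ d)
  interchange = solve-∀

∑-const : ∀ (xs : List A) c → ∑[ _ ∈ xs ] c ≡ length xs * c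
∑-const []       c = refl
∑-const (x ∷ xs) c = cong (c ℕ.+_) (∑-const xs c)

∑-zero : ∀ (xs : List A) → ∑[ _ ∈ xs ] 0 ≡ 0
∑-zero xs = trans (∑-const xs 0) (*-zeroʳ (length xs))

∑-map : ∀ (g : A → B) xs (f : B → ℕ) → ∑ (map g xs) f ≡ ∑[ x ∈ xs ] f (g x)
∑-map g xs f = cong sum (sym (map-∘ xs))

sum-concatMap : ∀ (g : A → List ℕ) xs → sum (concatMap g xs) ≡ ∑[ x ∈ xs ] sum (g x)
sum-concatMap g []       = refl
sum-concatMap g (x ∷ xs) = trans (sum-++ (g x) (concatMap g xs))
                                 (cong (sum (g x) ℕ.+_) (sum-concatMap g xs))

∑-concatMap : ∀ (g : A → List B) xs (f : B → ℕ) → ∑ (concatMap g xs) f ≡ ∑[ x ∈ xs ] ∑ (g x) f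
∑-concatMap g xs f = trans (cong sum (map-concatMap f g xs)) (sum-concatMap (map f ∘ g) xs)

∑-comm : ∀ (xs : List A) (ys : List B) (f : A → B → ℕ) →
         ∑[ x ∈ xs ] ∑[ y ∈ ys ] f x y ≡ ∑[ y ∈ ys ] ∑[ x ∈ xs ] f x y
∑-comm []       ys f = sym (∑-zero ys)
∑-comm (x ∷ xs) ys f = trans (cong (∑ ys (f x) ℕ.+_) (∑-comm xs ys f))
                             (sym (∑-+ ys (f x) (λ y → ∑[ x′ ∈ xs ] f x′ y)))

∑-upTo-suc : ∀ n (f : ℕ → ℕ) → ∑ (upTo (suc n)) f ≡ f 0 ℕ.+ ∑[ i ∈ upTo n ] f (suc i)
∑-upTo-suc n f = cong (λ fs → f 0 ℕ.+ sum fs)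
  (trans (map-applyUpTo suc f n) (sym (map-upTo (f ∘ suc) n)))

∑-upTo-∷ʳ : ∀ n (f : ℕ → ℕ) → ∑ (upTo (suc n)) f ≡ ∑ (upTo n) f ℕ.+ f n
∑-upTo-∷ʳ n f = begin
  ∑ (upTo (suc n)) f              ≡⟨ cong (λ is → ∑ is f) (upTo-∷ʳ n) ⟨
  ∑ (upTo n ++ [ n ]) f           ≡⟨ ∑-++ (upTo n) [ n ] f ⟩
  ∑ (upTo n) f ℕ.+ (f n ℕ.+ 0)    ≡⟨ cong (∑ (upTo n) f ℕ.+_) (+-identityʳ (f n)) ⟩
  ∑ (upTo n) f ℕ.+ f n            ∎

boxSum : (ℕ → ℕ → ℕ) → ℕ → ℕ → ℕ
boxSum f l m = ∑[ x ∈ upTo l ] ∑[ y ∈ upTo m ] f x y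

boxSum-inclusion–exclusion : ∀ f l m →
  boxSum f (suc l) (suc m) ℕ.+ boxSum f l m ≡ boxSum f l (suc m) ℕ.+ boxSum f (suc l) m ℕ.+ f l m
boxSum-inclusion–exclusion f l m = begin
  boxSum f (suc l) (suc m) ℕ.+ boxSum f l m
    ≡⟨ cong (ℕ._+ boxSum f l m) (∑-upTo-∷ʳ l (λ x → ∑ (upTo (suc m)) (f x))) ⟩
  boxSum f l (suc m) ℕ.+ ∑ (upTo (suc m)) (f l) ℕ.+ boxSum f l m
    ≡⟨ cong (λ s → boxSum f l (suc m) ℕ.+ s ℕ.+ boxSum f l m) (∑-upTo-∷ʳ m (f l)) ⟩
  boxSum f l (suc m) ℕ.+ (∑ (upTo m) (f l) ℕ.+ f l m) ℕ.+ boxSum f l m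
    ≡⟨ rearrange (boxSum f l (suc m)) (∑ (upTo m) (f l)) (f l m) (boxSum f l m) ⟩
  boxSum f l (suc m) ℕ.+ (boxSum f l m ℕ.+ ∑ (upTo m) (f l)) ℕ.+ f l m
    ≡⟨ cong (λ s → boxSum f l (suc m) ℕ.+ s ℕ.+ f l m) (∑-upTo-∷ʳ l (λ x → ∑ (upTo m) (f x))) ⟨
  boxSum f l (suc m) ℕ.+ boxSum f (suc l) m ℕ.+ f l m
    ∎
  where
  rearrange : ∀ a b c d → a ℕ.+ (b ℕ.+ c) ℕ.+ d ≡ a ℕ.+ (d ℕ.+ b) ℕ.+ c
  rearrange = solve-∀

absDiff-zeroˡ : ∀ y → absDiff 0 y ≡ y
absDiff-zeroˡ y = cong (ℕ._+ y) (0∸n≡0 y)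

absDiff-zeroʳ : ∀ x → absDiff x 0 ≡ x
absDiff-zeroʳ x = trans (cong (x ℕ.+_) (0∸n≡0 x)) (+-identityʳ x)

inExactlyOne : ℕ → ℕ → ℕ → ℕ
inExactlyOne x y j = if (j <ᵇ x) xor (j <ᵇ y) then 1 else 0

∑-inExactlyOne : ∀ C x y → x ≤ C → y ≤ C → ∑ (upTo C) (inExactlyOne x y) ≡ absDiff x y
∑-inExactlyOne zero    zero    zero    _       _       = refl
∑-inExactlyOne (suc C) zero    zero    _       _       =
  trans (∑-upTo-suc C (inExactlyOne 0 0)) (∑-inExactlyOne C 0 0 z≤n z≤n)
∑-inExactlyOne (suc C) zero    (suc y) _       (s≤s q) =
  trans (∑-upTo-suc C (inExactlyOne 0 (suc y)))
        (cong suc (trans (∑-inExactlyOne C 0 y z≤n q) (absDiff-zeroˡ y)))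
∑-inExactlyOne (suc C) (suc x) zero    (s≤s p) _       =
  trans (∑-upTo-suc C (inExactlyOne (suc x) 0))
        (trans (cong suc (trans (∑-inExactlyOne C x 0 p z≤n) (absDiff-zeroʳ x)))
               (sym (absDiff-zeroʳ (suc x))))
∑-inExactlyOne (suc C) (suc x) (suc y) (s≤s p) (s≤s q) =
  trans (∑-upTo-suc C (inExactlyOne (suc x) (suc y))) (∑-inExactlyOne C x y p q)

dist : ∀ {k} → Vec ℕ k → Vec ℕ k → ℕ
dist []       []       = 0
dist (x ∷ xs) (y ∷ ys) = absDiff x y ℕ.+ dist xs ys

∑-absDiff-row : ∀ {k} R (u v : Vec ℕ k) → k ≤ R →
  ∑[ i ∈ upTo R ] absDiff (row u i) (row v i) ≡ dist u v
∑-absDiff-row R       []       []       _         = ∑-zero (upTo R)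
∑-absDiff-row (suc R) (x ∷ xs) (y ∷ ys) (s≤s k≤R) =
  trans (∑-upTo-suc R (λ i → absDiff (row (x ∷ xs) i) (row (y ∷ ys) i)))
        (cong (absDiff x y ℕ.+_) (∑-absDiff-row R xs ys k≤R))

RowsAtMost : ∀ {k} → ℕ → Vec ℕ k → Set
RowsAtMost b v = ∀ i → row v i ≤ b

symDiffCard≡dist : ∀ {k} R C (u v : Vec ℕ k) → k ≤ R → RowsAtMost C u → RowsAtMost C v →
  symDiffCard R C u v ≡ dist u v
symDiffCard≡dist R C u v k≤R u≤C v≤C =
  trans (∑-cong (upTo R) (λ i → ∑-inExactlyOne C (row u i) (row v i) (u≤C i) (v≤C i)))
        (∑-absDiff-row R u v k≤R)

Par-rowsAtMost : ∀ a b → All (RowsAtMost b) (Par a b)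
Par-rowsAtMost zero    b = (λ _ → z≤n) ∷ []
Par-rowsAtMost (suc a) b = concat⁺ (map⁺ (applyUpTo⁺₁ (λ x → x) (suc b) (λ x<1+b →
  map⁺ (All.map (cons-rowsAtMost (≤-pred x<1+b)) (Par-rowsAtMost a _)))))
  where
  cons-rowsAtMost : ∀ {k x} {v : Vec ℕ k} → x ≤ b → RowsAtMost x v → RowsAtMost b (x ∷ v)
  cons-rowsAtMost x≤b v≤x zero    = x≤b
  cons-rowsAtMost x≤b v≤x (suc i) = ≤-trans (v≤x i) x≤b

totalDist : ℕ → ℕ → ℕ → ℕ
totalDist k l m = ∑[ u ∈ Par k l ] ∑[ v ∈ Par k m ] dist u v

S⊖≡totalDist : ∀ k l m → S⊖ k l k m ≡ totalDist k l m
S⊖≡totalDist k l m =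
  trans (sum-concatMap _ (Par k l))
        (∑-cong-All (Par-rowsAtMost k l) λ {u} u≤l → ∑-cong-All (Par-rowsAtMost k m) λ {v} v≤m →
           symDiffCard≡dist (k ℕ.+ k) (l ℕ.+ m) u v (m≤m+n k k)
             (λ i → ≤-trans (u≤l i) (m≤m+n l m)) (λ i → ≤-trans (v≤m i) (m≤n+m m l)))

∑-Par-suc : ∀ k l (g : Vec ℕ (suc k) → ℕ) →
  ∑ (Par (suc k) l) g ≡ ∑[ x ∈ upTo (suc l) ] ∑[ v ∈ Par k x ] g (x ∷ v)
∑-Par-suc k l g = trans (∑-concatMap (λ x → map (x ∷_) (Par k x)) (upTo (suc l)) g)
                        (∑-cong (upTo (suc l)) (λ x → ∑-map (x ∷_) (Par k x) g))

blockDist : ℕ → ℕ → ℕ → ℕ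
blockDist k x y = absDiff x y * #Par k x * #Par k y ℕ.+ totalDist k x y

∑∑-dist-∷ : ∀ k x y → ∑[ v ∈ Par k x ] ∑[ w ∈ Par k y ] dist (x ∷ v) (y ∷ w) ≡ blockDist k x y
∑∑-dist-∷ k x y = begin
  ∑[ v ∈ P ] ∑[ w ∈ Q ] (a ℕ.+ dist v w)
    ≡⟨ ∑-cong P (λ v → trans (∑-+ Q (λ _ → a) (dist v)) (cong (ℕ._+ ∑ Q (dist v)) (∑-const Q a))) ⟩
  ∑[ v ∈ P ] (#Par k y * a ℕ.+ ∑ Q (dist v))
    ≡⟨ ∑-+ P (λ _ → #Par k y * a) (λ v → ∑ Q (dist v)) ⟩
  ∑[ _ ∈ P ] (#Par k y * a) ℕ.+ totalDist k x y
    ≡⟨ cong (ℕ._+ totalDist k x y) (trans (∑-const P _) (reorder (#Par k x) (#Par k y) a)) ⟩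
  blockDist k x y
    ∎
  where
  P Q : List (Vec ℕ k)
  P = Par k x
  Q = Par k y
  a : ℕ
  a = absDiff x y
  reorder : ∀ p q a → p * (q * a) ≡ a * p * q
  reorder = solve-∀

totalDist-suc : ∀ k l m → totalDist (suc k) l m ≡ boxSum (blockDist k) (suc l) (suc m)
totalDist-suc k l m = begin
  totalDist (suc k) l m
    ≡⟨ ∑-Par-suc k l (λ u → ∑ (Par (suc k) m) (dist u)) ⟩
  ∑[ x ∈ upTo (suc l) ] ∑[ v ∈ Par k x ] ∑[ μ ∈ Par (suc k) m ] dist (x ∷ v) μ
    ≡⟨ ∑-cong (upTo (suc l)) (λ x → ∑-cong (Par k x) (λ v → ∑-Par-suc k m (dist (x ∷ v)))) ⟩
  ∑[ x ∈ upTo (suc l) ] ∑[ v ∈ Par k x ] ∑[ y ∈ upTo (suc m) ] ∑[ w ∈ Par k y ] dist (x ∷ v) (y ∷ w)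
    ≡⟨ ∑-cong (upTo (suc l)) (λ x → ∑-comm (Par k x) (upTo (suc m)) _) ⟩
  ∑[ x ∈ upTo (suc l) ] ∑[ y ∈ upTo (suc m) ] ∑[ v ∈ Par k x ] ∑[ w ∈ Par k y ] dist (x ∷ v) (y ∷ w)
    ≡⟨ ∑-cong (upTo (suc l)) (λ x → ∑-cong (upTo (suc m)) (∑∑-dist-∷ k x)) ⟩
  boxSum (blockDist k) (suc l) (suc m)
    ∎

S⊖-suc : ∀ k l m → S⊖ (suc k) l (suc k) m ≡ boxSum (blockDist k) (suc l) (suc m)
S⊖-suc k l m = trans (S⊖≡totalDist (suc k) l m) (totalDist-suc k l m)

S⊖-inclusion–exclusion : ∀ k l m →
  S⊖ (suc k) (suc l) (suc k) (suc m) ℕ.+ S⊖ (suc k) l (suc k) m ≡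
  S⊖ (suc k) l (suc k) (suc m) ℕ.+ S⊖ (suc k) (suc l) (suc k) m
    ℕ.+ (absDiff (suc l) (suc m) * #Par k (suc l) * #Par k (suc m) ℕ.+ S⊖ k (suc l) k (suc m))
S⊖-inclusion–exclusion k l m = begin
  S⊖ (suc k) (suc l) (suc k) (suc m) ℕ.+ S⊖ (suc k) l (suc k) m
    ≡⟨ cong₂ ℕ._+_ (S⊖-suc k (suc l) (suc m)) (S⊖-suc k l m) ⟩
  boxSum F (suc (suc l)) (suc (suc m)) ℕ.+ boxSum F (suc l) (suc m)
    ≡⟨ boxSum-inclusion–exclusion F (suc l) (suc m) ⟩
  boxSum F (suc l) (suc (suc m)) ℕ.+ boxSum F (suc (suc l)) (suc m) ℕ.+ F (suc l) (suc m)
    ≡⟨ cong₂ ℕ._+_ (cong₂ ℕ._+_ (sym (S⊖-suc k l (suc m))) (sym (S⊖-suc k (suc l) m)))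
                   (cong (absDiff (suc l) (suc m) * #Par k (suc l) * #Par k (suc m) ℕ.+_)
                         (sym (S⊖≡totalDist k (suc l) (suc m)))) ⟩
  S⊖ (suc k) l (suc k) (suc m) ℕ.+ S⊖ (suc k) (suc l) (suc k) m
    ℕ.+ (absDiff (suc l) (suc m) * #Par k (suc l) * #Par k (suc m) ℕ.+ S⊖ k (suc l) k (suc m))
    ∎
  where
  F : ℕ → ℕ → ℕ
  F = blockDist k

+-transpose-ℤ : ∀ {s a b c d e} → s ℕ.+ c ≡ a ℕ.+ b ℕ.+ (e ℕ.+ d) →
                + s ≡ + a + + b - + c + + d + + e
+-transpose-ℤ {s} {a} {b} {c} {d} {e} eq = begin
  + s                                   ≡⟨ cancel (+ s) (+ c) ⟩
  + s + + c - + c                       ≡⟨ cong (_- + c) (pos-+ s c) ⟨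
  + (s ℕ.+ c) - + c                     ≡⟨ cong (λ n → + n - + c) eq ⟩
  + (a ℕ.+ b ℕ.+ (e ℕ.+ d)) - + c       ≡⟨ cong (_- + c) (trans (pos-+ (a ℕ.+ b) (e ℕ.+ d))
                                                                (cong₂ _+_ (pos-+ a b) (pos-+ e d))) ⟩
  + a + + b + (+ e + + d) - + c         ≡⟨ rearrange (+ a) (+ b) (+ c) (+ d) (+ e) ⟩
  + a + + b - + c + + d + + e           ∎
  where
  cancel : ∀ x y → x ≡ x + y - y
  cancel = ℤ-Solver.solve-∀
  rearrange : ∀ a b c d e → a + b + (e + d) - c ≡ a + b - c + d + e
  rearrange = ℤ-Solver.solve-∀

lemma2p3 : ∀ (k l m : ℕ) → 1 ≤ k → 1 ≤ l → 1 ≤ m →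
    + S⊖ k l k m ≡
      + S⊖ k (l ∸ 1) k m + + S⊖ k l k (m ∸ 1) - + S⊖ k (l ∸ 1) k (m ∸ 1)
      + + S⊖ (k ∸ 1) l (k ∸ 1) m
      + + (absDiff l m * #Par (k ∸ 1) l * #Par (k ∸ 1) m)
lemma2p3 (suc k) (suc l) (suc m) _ _ _ =
  +-transpose-ℤ {a = S⊖ (suc k) l (suc k) (suc m)} {b = S⊖ (suc k) (suc l) (suc k) m}
                {c = S⊖ (suc k) l (suc k) m}
                (S⊖-inclusion–exclusion k l m)
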